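{- There exists a function $f:\mathbb{N}\to\mathbb{N}$ that is definable by an arithmetic circuit (i.e. there is an arithmetic circuit $\tau(x)$ with $\tau(\{n\})=\{f(n)\}$ for all $n\in\mathbb{N}$) and is not bounded by any polynomial.
   Context: $\mathbb{N}=\{0,1,2,\ldots\}$. For $s,t\subseteq\mathbb{N}$, $s\oplus t=\{m+n\mid m\in s,n\in t\}$ and $s\otimes t=\{mn\mid m\in s,n\in t\}$. An arithmetic circuit is a term built from variables ranging over subsets of $\mathbb{N}$, the constants $\emptyset$, $\mathbb{N}$, $\{n\}$ ($n\in\mathbb{N}$), and the operations $\cup$, $\cap$, complement relative to $\mathbb{N}$, $\oplus$ and $\otimes$; it is evaluated in the obvious way. -}

module Defs where

open import Data.Nat using (ℕ; _+_; _*_; _≤_)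
open import Data.List using (List; []; _∷_)
open import Data.Product using (∃; ∃-syntax; _×_)
open import Data.Sum using (_⊎_)
open import Data.Empty using (⊥)
open import Data.Unit using (⊤)
open import Relation.Nullary using (¬_)
open import Relation.Binary.PropositionalEquality using (_≡_)
open import Function.Bundles using (_⇔_)

SubsetN : Set₁
SubsetN = ℕ → Set

_∈_ : ℕ → SubsetN → Set
m ∈ s = s m

data Circuit : Set where
  var   : Circuit
  empty : Circuit
  full  : Circuit
  sing  : ℕ → Circuit
  _∪ᶜ_  : Circuit → Circuit → Circuit
  _∩ᶜ_  : Circuit → Circuit → Circuit
  compl : Circuit → Circuit
  _⊕ᶜ_  : Circuit → Circuit → Circuit
  _⊗ᶜ_  : Circuit → Circuit → Circuit

eval : Circuit → SubsetN → SubsetN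
eval var       s k = s k
eval empty     s k = ⊥
eval full      s k = ⊤
eval (sing n)  s k = k ≡ n
eval (a ∪ᶜ b)  s k = eval a s k ⊎ eval b s k
eval (a ∩ᶜ b)  s k = eval a s k × eval b s k
eval (compl a) s k = ¬ eval a s k
eval (a ⊕ᶜ b)  s k = ∃[ m ] ∃[ n ] (eval a s m × eval b s n × k ≡ m + n)
eval (a ⊗ᶜ b)  s k = ∃[ m ] ∃[ n ] (eval a s m × eval b s n × k ≡ m * n)

⟦_⟧ : ℕ → SubsetN
⟦ n ⟧ k = k ≡ n

CircuitDefinable : (ℕ → ℕ) → Set
CircuitDefinable f = ∃[ τ ] ((n m : ℕ) → (m ∈ eval τ ⟦ n ⟧) ⇔ (m ≡ f n))

-- Polynomials with natural-number coefficients, as coefficient lists (lowest degree first).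
evalPoly : List ℕ → ℕ → ℕ
evalPoly []       x = 0
evalPoly (c ∷ cs) x = c + x * evalPoly cs x

BoundedByPolynomial : (ℕ → ℕ) → Set
BoundedByPolynomial f = ∃[ p ] ((n : ℕ) → f n ≤ evalPoly p n)

module Submission where

-- For input n, put q = n + 1 and consider the set
--   Candidate n = { m ≥ 2 | every divisor d ≥ 2 of m is a multiple of q,
--                           and m ≡ 1 (mod n²) }.
-- If q is prime, the first condition says exactly that m is a power q^j,
-- and since (1 + n)^j ≡ 1 + j·n (mod n²) the second one forces n ∣ j; so
-- the least candidate is q^n.  If q is not prime the set is empty.
-- Each of the three conditions is a circuit in x = {n}, and a circuit
-- can pick out the least element of a set (or 0 when the set is empty).
-- Hence f(n) = (n + 1)^n for prime n + 1, f(n) = 0 otherwise, is circuit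
-- definable; as there are infinitely many primes, f exceeds every
-- polynomial.

open import Defs
open import Data.Nat using (ℕ)
open import Data.Product using (∃-syntax; _×_)
open import Relation.Nullary using (¬_)

open import Data.Nat
  using (zero; suc; _+_; _*_; _∸_; _^_; _≤_; _<_; z≤n; s≤s; s≤s⁻¹; _≤?_; _!; NonZero; nonTrivial⇒n>1; nonTrivial⇒nonZero)
open import Data.Nat.Properties
open import Data.Nat.Divisibility
  using (_∣_; divides; _∣?_; ∣m+n∣m⇒∣n; m∣m*n; *-cancelʳ-∣; ∣1⇒≡1; ∣-trans; ∣⇒≤; ∣-refl; m≤n⇒m!∣n!)
open import Data.Nat.Primality
  using (prime?; Prime; Composite; ¬prime[0]; ¬prime[1]; ¬prime⇒composite; prime⇒irreducible; prime⇒nonTrivial)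
open import Data.Nat.Divisibility.Core using (hasNonTrivialDivisor)
open import Data.Nat.GCD using (gcd[m,n]∣m; gcd[m,n]∣n)
open import Data.Nat.Coprimality using (gcd≡1⇒coprime; coprime-divisor)
open import Data.Nat.Primality.Factorisation using (factorise)
open import Data.Nat.ListAction using (sum; product)
open import Data.Nat.Solver using (module +-*-Solver)
open import Data.Nat.Induction using (<-wellFounded)
open import Induction.WellFounded using (Acc; acc)
open import Data.List using ([]; _∷_; length)
open import Data.List.Relation.Unary.All using (_∷_)
open import Data.Product using (_,_; proj₁; proj₂)
open import Data.Sum using (inj₁; inj₂)
open import Data.Unit using (tt)
open import Relation.Nullary using (yes; no; contradiction)
open import Relation.Binary.PropositionalEquality using (_≡_; refl; sym; trans; cong; cong₂; subst)
open import Function using (id)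
open import Function.Bundles using (_⇔_; mk⇔; Equivalence)

open Equivalence using (to; from)

private variable
  s P Q : SubsetN
  b c : Circuit
  a m n q v : ℕ

record Computes (s : SubsetN) (c : Circuit) (P : SubsetN) : Set where
  constructor computes
  field
    membership : ∀ k → (k ∈ eval c s) ⇔ P k

open Computes

sound : Computes s c P → ∀ {k} → k ∈ eval c s → P k
sound C {k} = to (membership C k)

complete : Computes s c P → ∀ {k} → P k → k ∈ eval c s
complete C {k} = from (membership C k)

input-computes : Computes ⟦ n ⟧ var (_≡ n)
input-computes = computes λ _ → mk⇔ id id

∩-computes : Computes s b P → Computes s c Q → Computes s (b ∩ᶜ c) (λ k → P k × Q k)
∩-computes B C = computes λ _ → mk⇔ (λ { (x , y) → sound B x , sound C y })
                                     (λ { (x , y) → complete B x , complete C y })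

successor-computes : Computes s c (_≡ a) → Computes s (c ⊕ᶜ sing 1) (_≡ suc a)
successor-computes {s = s} {c = c} {a = a} C =
  computes λ _ → mk⇔ forward (λ k≡ → a , 1 , complete C refl , refl , trans k≡ (sym (+-comm a 1)))
  where
  forward : ∀ {k} → k ∈ eval (c ⊕ᶜ sing 1) s → k ≡ suc a
  forward (m , _ , cm , refl , k≡) = trans k≡ (trans (+-comm m 1) (cong suc (sound C cm)))

multiplesC : Circuit → Circuit
multiplesC c = c ⊗ᶜ full

multiples-computes : Computes s c (_≡ a) → Computes s (multiplesC c) (a ∣_)
multiples-computes {s = s} {c = c} {a = a} C = computes λ _ → mk⇔ forward backward
  where
  forward : ∀ {k} → k ∈ eval (multiplesC c) s → a ∣ k
  forward (m , e , cm , tt , k≡) = divides e (trans k≡ (trans (cong (_* e) (sound C cm)) (*-comm a e)))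
  backward : ∀ {k} → a ∣ k → k ∈ eval (multiplesC c) s
  backward (divides e k≡) = a , e , complete C refl , tt , trans k≡ (*-comm e a)

atLeastTwoC : Circuit
atLeastTwoC = sing 2 ⊕ᶜ full

atLeastTwo-computes : Computes s atLeastTwoC (2 ≤_)
atLeastTwo-computes {s = s} = computes λ k → mk⇔ forward (λ 2≤k → 2 , k ∸ 2 , refl , tt , sym (m+[n∸m]≡n 2≤k))
  where
  forward : ∀ {k} → k ∈ eval atLeastTwoC s → 2 ≤ k
  forward (_ , e , refl , tt , k≡) = ≤-trans (m≤m+n 2 e) (≤-reflexive (sym k≡))

aboveC : Circuit → Circuit
aboveC c = c ⊕ᶜ (sing 1 ⊕ᶜ full)

above-computes : Computes s c P → Computes s (aboveC c) (λ k → ∃[ m ] (P m × m < k))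
above-computes {s = s} {c = c} {P = P} C = computes λ _ → mk⇔ forward backward
  where
  forward : ∀ {k} → k ∈ eval (aboveC c) s → ∃[ m ] (P m × m < k)
  forward (m , _ , cm , (_ , e , refl , tt , refl) , k≡) =
    m , sound C cm , ≤-trans (m<m+n m (s≤s z≤n)) (≤-reflexive (sym k≡))
  backward : ∀ {k} → ∃[ m ] (P m × m < k) → k ∈ eval (aboveC c) s
  backward {k} (m , pm , m<k) =
    m , k ∸ m , complete C pm ,
    (1 , k ∸ m ∸ 1 , refl , tt , sym (m+[n∸m]≡n (m<n⇒0<n∸m m<k))) ,
    sym (m+[n∸m]≡n (<⇒≤ m<k))

nonemptyC : Circuit → Circuit
nonemptyC c = c ⊗ᶜ sing 0

nonempty-computes : Computes s c P → Computes s (nonemptyC c) (λ k → k ≡ 0 × ∃[ m ] P m)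
nonempty-computes {s = s} {c = c} {P = P} C = computes λ _ → mk⇔ forward backward
  where
  forward : ∀ {k} → k ∈ eval (nonemptyC c) s → k ≡ 0 × ∃[ m ] P m
  forward (m , _ , cm , refl , k≡) = trans k≡ (*-zeroʳ m) , m , sound C cm
  backward : ∀ {k} → k ≡ 0 × ∃[ m ] P m → k ∈ eval (nonemptyC c) s
  backward (k≡0 , m , pm) = m , 0 , complete C pm , refl , trans k≡0 (sym (*-zeroʳ m))

leastOrZeroC : Circuit → Circuit
leastOrZeroC c = (c ∩ᶜ compl (aboveC c)) ∪ᶜ (sing 0 ∩ᶜ compl (nonemptyC c))

leastOrZero-least : Computes s c P → P v → (∀ m → P m → v ≤ m) →
                    Computes s (leastOrZeroC c) (_≡ v)
leastOrZero-least {s = s} {c = c} {v = v} C pv least = computes λ _ → mk⇔ forward backward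
  where
  forward : ∀ {k} → k ∈ eval (leastOrZeroC c) s → k ≡ v
  forward {k} (inj₁ (ck , nothingBelow)) =
    ≤-antisym (≮⇒≥ (λ v<k → nothingBelow (complete (above-computes C) (v , pv , v<k))))
              (least k (sound C ck))
  forward (inj₂ (k≡0 , cEmpty)) = contradiction (complete (nonempty-computes C) (k≡0 , v , pv)) cEmpty
  backward : ∀ {k} → k ≡ v → k ∈ eval (leastOrZeroC c) s
  backward refl = inj₁ (complete C pv , λ below →
    let (m , pm , m<v) = sound (above-computes C) below in <⇒≱ m<v (least m pm))

leastOrZero-empty : Computes s c P → (∀ m → ¬ P m) → Computes s (leastOrZeroC c) (_≡ 0)
leastOrZero-empty {s = s} {c = c} C noElement = computes λ _ → mk⇔ forward backward
  where
  forward : ∀ {k} → k ∈ eval (leastOrZeroC c) s → k ≡ 0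
  forward {k} (inj₁ (ck , _)) = contradiction (sound C ck) (noElement k)
  forward (inj₂ (k≡0 , _)) = k≡0
  backward : ∀ {k} → k ≡ 0 → k ∈ eval (leastOrZeroC c) s
  backward k≡0 = inj₂ (k≡0 , λ x → let (_ , m , pm) = sound (nonempty-computes C) x in noElement m pm)

FactorsDivisibleBy : ℕ → ℕ → Set
FactorsDivisibleBy q m = ∀ d → d ∣ m → 2 ≤ d → q ∣ d

-- Powers of a prime q have this property: a divisor d ≥ 2 of q^(j+1) either
-- shares the factor q with it or divides q^j.
prime-power-factorsDivisible : Prime q → ∀ j → FactorsDivisibleBy q (q ^ j)
prime-power-factorsDivisible pq zero d d∣1 2≤d = contradiction (≤-reflexive (∣1⇒≡1 d∣1)) (<⇒≱ 2≤d)
prime-power-factorsDivisible {q} pq (suc j) d d∣qq^j 2≤d with prime⇒irreducible pq (gcd[m,n]∣n d q)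
... | inj₂ gcd≡q = subst (_∣ d) gcd≡q (gcd[m,n]∣m d q)
... | inj₁ gcd≡1 = prime-power-factorsDivisible pq j d (coprime-divisor (gcd≡1⇒coprime gcd≡1) d∣qq^j) 2≤d

-- Conversely, for prime q the positive m with FactorsDivisibleBy q m are powers of q:
-- m is a multiple c·q, and c inherits the property.
factorsDivisible⇒prime-power : Prime q → FactorsDivisibleBy q m → 1 ≤ m → ∃[ j ] (m ≡ q ^ j)
factorsDivisible⇒prime-power {q = q} {m = m} pq = go m (<-wellFounded m)
  where
  2≤q : 2 ≤ q
  2≤q = nonTrivial⇒n>1 q {{prime⇒nonTrivial pq}}
  go : ∀ m → Acc _<_ m → FactorsDivisibleBy q m → 1 ≤ m → ∃[ j ] (m ≡ q ^ j)
  go zero _ _ ()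
  go (suc zero) _ _ _ = 0 , refl
  go m@(suc (suc _)) (acc smaller) F _ with F m ∣-refl (s≤s (s≤s z≤n))
  ... | divides c@(suc _) m≡cq with go c (smaller c<m) (λ d d∣c → F d (∣-trans d∣c c∣m)) (s≤s z≤n)
    where
    c<m : c < m
    c<m = subst (c <_) (sym m≡cq) (m<m*n c q 2≤q)
    c∣m : c ∣ m
    c∣m = divides q (trans m≡cq (*-comm c q))
  ... | j , c≡q^j = suc j , trans m≡cq (trans (cong (_* q) c≡q^j) (*-comm (q ^ j) q))

-- If some m ≥ 2 has FactorsDivisibleBy q then q is not composite: a proper
-- divisor d ≥ 2 of q divides m, so q ∣ d, contradicting d < q.
factorsDivisible⇒¬composite : FactorsDivisibleBy q m → 2 ≤ m → ¬ Composite q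
factorsDivisible⇒¬composite {q} {m} F 2≤m (hasNonTrivialDivisor {d} d<q d∣q) =
  <⇒≱ d<q (∣⇒≤ {{nonTrivial⇒nonZero d}} (F d (∣-trans d∣q (F m ∣-refl 2≤m)) (nonTrivial⇒n>1 d)))

binomial-mod-square : ∀ n j → ∃[ X ] (suc n ^ j ≡ 1 + j * n + n * n * X)
binomial-mod-square n zero = 0 , cong suc (sym (*-zeroʳ (n * n)))
binomial-mod-square n (suc j) =
  let (X , eq) = binomial-mod-square n j in
  X + j + n * X , trans (cong (suc n *_) eq) (expand n j X)
  where
  open +-*-Solver
  expand : ∀ n j X → suc n * (1 + j * n + n * n * X) ≡ 1 + suc j * n + n * n * (X + j + n * X)
  expand = solve 3 (λ n j X → (con 1 :+ n) :* (con 1 :+ j :* n :+ n :* n :* X)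
                     := con 1 :+ (con 1 :+ j) :* n :+ n :* n :* (X :+ j :+ n :* X)) refl

exponent-divisible : ∀ n j t .{{_ : NonZero n}} → suc n ^ j ≡ n * n * t + 1 → n ∣ j
exponent-divisible n j t eq =
  let (X , expansion) = binomial-mod-square n j
      j*n+n²X≡n²t : j * n + n * n * X ≡ n * n * t
      j*n+n²X≡n²t = suc-injective (trans (sym expansion) (trans eq (+-comm (n * n * t) 1)))
      n²∣n²X+j*n : n * n ∣ n * n * X + j * n
      n²∣n²X+j*n = subst (n * n ∣_) (trans (sym j*n+n²X≡n²t) (+-comm (j * n) (n * n * X))) (m∣m*n t)
  in *-cancelʳ-∣ n (∣m+n∣m⇒∣n n²∣n²X+j*n (m∣m*n X))

OneModSquare : ℕ → ℕ → Set
OneModSquare n m = ∃[ t ] (m ≡ n * n * t + 1)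

factorsDivisibleC : Circuit → Circuit
factorsDivisibleC c = compl (full ⊗ᶜ (compl (multiplesC c) ∩ᶜ atLeastTwoC))

factorsDivisible-computes : Computes s c (_≡ a) → Computes s (factorsDivisibleC c) (FactorsDivisibleBy a)
factorsDivisible-computes {s = s} {c = c} {a = a} C = computes λ _ → mk⇔ forward backward
  where
  M = multiples-computes C
  forward : ∀ {k} → k ∈ eval (factorsDivisibleC c) s → FactorsDivisibleBy a k
  forward none d (divides e k≡) 2≤d with a ∣? d
  ... | yes a∣d = a∣d
  ... | no a∤d = contradiction (e , d , tt , ((λ x → a∤d (sound M x)) , complete (atLeastTwo-computes {s = s}) 2≤d) , k≡) none
  backward : ∀ {k} → FactorsDivisibleBy a k → k ∈ eval (factorsDivisibleC c) s
  backward F (e , d , tt , (notMultiple , big) , k≡) =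
    notMultiple (complete M (F d (divides e k≡) (sound (atLeastTwo-computes {s = s}) big)))

oneModSquareC : Circuit → Circuit
oneModSquareC c = ((c ⊗ᶜ c) ⊗ᶜ full) ⊕ᶜ sing 1

oneModSquare-computes : Computes s c (_≡ a) → Computes s (oneModSquareC c) (OneModSquare a)
oneModSquare-computes {s = s} {c = c} {a = a} C = computes λ _ → mk⇔ forward backward
  where
  forward : ∀ {k} → k ∈ eval (oneModSquareC c) s → OneModSquare a k
  forward (x , _ , (y , t , (u , w , cu , cw , y≡) , tt , x≡) , refl , k≡) =
    t , trans k≡ (cong (_+ 1) (trans x≡ (cong (_* t) (trans y≡ (cong₂ _*_ (sound C cu) (sound C cw))))))
  backward : ∀ {k} → OneModSquare a k → k ∈ eval (oneModSquareC c) s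
  backward (t , k≡) =
    a * a * t , 1 , (a * a , t , (a , a , complete C refl , complete C refl , refl) , tt , refl) , refl , k≡

Candidate : ℕ → ℕ → Set
Candidate n m = (FactorsDivisibleBy (suc n) m × OneModSquare n m) × 2 ≤ m

candidateC : Circuit
candidateC = (factorsDivisibleC (var ⊕ᶜ sing 1) ∩ᶜ oneModSquareC var) ∩ᶜ atLeastTwoC

candidate-computes : ∀ n → Computes ⟦ n ⟧ candidateC (Candidate n)
candidate-computes n =
  ∩-computes (∩-computes (factorsDivisible-computes (successor-computes input-computes))
                         (oneModSquare-computes input-computes))
             atLeastTwo-computes

-- For prime q = n + 1 every candidate is a power q^j with n ∣ j and j ≠ 0, hence ≥ q^n …
candidate-least : Prime (suc n) → Candidate n m → suc n ^ n ≤ m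
candidate-least {zero} p1 _ = contradiction p1 ¬prime[1]
candidate-least {n@(suc _)} {m} pq ((F , t , m≡) , 2≤m)
  with factorsDivisible⇒prime-power pq F (≤-trans (s≤s z≤n) 2≤m)
... | j , m≡q^j with exponent-divisible n j t (trans (sym m≡q^j) m≡)
...   | divides zero refl = contradiction (≤-reflexive m≡q^j) (<⇒≱ 2≤m)
...   | divides (suc e) refl = subst (suc n ^ n ≤_) (sym m≡q^j) (^-monoʳ-≤ (suc n) (m≤m+n n (e * n)))

-- … and q^n itself is a candidate, as q^n = 1 + n·n + n·n·X.
candidate-power : Prime (suc n) → Candidate n (suc n ^ n)
candidate-power {zero} p1 = contradiction p1 ¬prime[1]
candidate-power {n@(suc k)} pq =
  (prime-power-factorsDivisible pq n , suc X , trans expansion (regroup n X)) , 2≤q^n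
  where
  X = proj₁ (binomial-mod-square n n)
  expansion = proj₂ (binomial-mod-square n n)
  open +-*-Solver
  regroup : ∀ n X → 1 + n * n + n * n * X ≡ n * n * (1 + X) + 1
  regroup = solve 2 (λ n X → con 1 :+ n :* n :+ n :* n :* X := n :* n :* (con 1 :+ X) :+ con 1) refl
  2≤q^n : 2 ≤ suc n ^ n
  2≤q^n = ≤-trans (s≤s (s≤s z≤n)) (m≤m*n (suc n) (suc n ^ k) {{m^n≢0 (suc n) k}})

-- When n + 1 is not prime there is no candidate: for n = 0 the congruence
-- forces m = 1, otherwise n + 1 would have to be composite.
no-candidate : ¬ Prime (suc n) → ¬ Candidate n m
no-candidate {zero} _ ((_ , _ , refl) , s≤s ())
no-candidate {suc _} np ((F , _) , 2≤m) = factorsDivisible⇒¬composite F 2≤m (¬prime⇒composite np)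

prime-divisor : ∀ n → 2 ≤ n → ∃[ p ] (Prime p × p ∣ n)
prime-divisor n@(suc _) 2≤n with factorise n
... | record { factors = [] ; isFactorisation = n≡1 } = contradiction (≤-reflexive n≡1) (<⇒≱ 2≤n)
... | record { factors = p ∷ ps ; isFactorisation = n≡ ; factorsPrime = pp ∷ _ } =
  p , pp , divides (product ps) (trans n≡ (*-comm p (product ps)))

-- Euclid: there are arbitrarily large primes, as every prime factor of N! + 1 exceeds N.
prime-above : ∀ N → ∃[ p ] (Prime p × N < p)
prime-above N with prime-divisor (suc (N !)) (s≤s (1≤n! N))
... | zero , p0 , _ = contradiction p0 ¬prime[0]
... | p@(suc p′) , pp , p∣N!+1 with p ≤? N
...   | no p≰N = p , pp , ≰⇒> p≰N
...   | yes p≤N = contradiction (subst Prime (∣1⇒≡1 p∣1) pp) ¬prime[1]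
  where
  p∣N! : p ∣ N !
  p∣N! = ∣-trans (m∣m*n (p′ !)) (m≤n⇒m!∣n! p≤N)
  p∣1 : p ∣ 1
  p∣1 = ∣m+n∣m⇒∣n (subst (p ∣_) (+-comm 1 (N !)) p∣N!+1) p∣N!

evalPoly<pow : ∀ p x → sum p < x → evalPoly p x < x ^ length p
evalPoly<pow [] x _ = s≤s z≤n
evalPoly<pow (c ∷ cs) x c+Σcs<x = begin-strict
  c + x * evalPoly cs x   <⟨ +-monoˡ-< (x * evalPoly cs x) (≤-<-trans (m≤m+n c (sum cs)) c+Σcs<x) ⟩
  x + x * evalPoly cs x   ≡⟨ sym (*-suc x (evalPoly cs x)) ⟩
  x * suc (evalPoly cs x) ≤⟨ *-monoʳ-≤ x (evalPoly<pow cs x (≤-<-trans (m≤n+m (sum cs) c) c+Σcs<x)) ⟩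
  x * x ^ length cs       ∎
  where open ≤-Reasoning

f : ℕ → ℕ
f n with prime? (suc n)
... | yes _ = suc n ^ n
... | no _ = 0

f-at-prime : Prime (suc n) → f n ≡ suc n ^ n
f-at-prime {n} pq with prime? (suc n)
... | yes _ = refl
... | no np = contradiction pq np

f-computed : ∀ n → Computes ⟦ n ⟧ (leastOrZeroC candidateC) (_≡ f n)
f-computed n with prime? (suc n)
... | yes pq = leastOrZero-least (candidate-computes n) (candidate-power pq) (λ _ → candidate-least pq)
... | no np = leastOrZero-empty (candidate-computes n) (λ _ → no-candidate np)

polynomial<f : ∀ p n → Prime (suc n) → sum p + length p < n → evalPoly p n < f n
polynomial<f p n pq small = begin-strict
  evalPoly p n     <⟨ evalPoly<pow p n (≤-<-trans (m≤m+n (sum p) (length p)) small) ⟩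
  n ^ length p     ≤⟨ ^-monoˡ-≤ (length p) (n≤1+n n) ⟩
  suc n ^ length p ≤⟨ ^-monoʳ-≤ (suc n) (≤-trans (m≤n+m (length p) (sum p)) (<⇒≤ small)) ⟩
  suc n ^ n        ≡⟨ sym (f-at-prime pq) ⟩
  f n              ∎
  where open ≤-Reasoning

theorem11 : ∃[ f ] (CircuitDefinable f × ¬ BoundedByPolynomial f)
theorem11 = f , (leastOrZeroC candidateC , λ n → membership (f-computed n)) , unbounded
  where
  unbounded : ¬ BoundedByPolynomial f
  unbounded (p , bounded) with prime-above (suc (sum p + length p))
  ... | zero , p0 , _ = contradiction p0 ¬prime[0]
  ... | suc n , pq , above = <⇒≱ (polynomial<f p n pq (s≤s⁻¹ above)) (bounded n)
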